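{- Let $N'(X',Y',z')$ and $N''(X'',Y'',z'')$ be single-output combinational circuits with input variable sets $X'=\{x'_1,\dots,x'_k\}$ and $X''=\{x''_1,\dots,x''_k\}$ (disjoint from each other), internal variable sets $Y'$, $Y''$, and output variables $z'$, $z''$; all four variable sets $X',Y',X'',Y''$ and the variables $z',z''$ are pairwise disjoint. Let $F'(X',Y',z')$ and $F''(X'',Y'',z'')$ be CNF formulas specifying $N'$ and $N''$ respectively. Let $\mathit{EQ}(X',X'')$ denote the formula $(x'_1\equiv x''_1)\wedge\dots\wedge(x'_k\equiv x''_k)$, and let $W=X'\cup X''\cup Y'\cup Y''$. Let $H(z',z'')$ be any quantifier-free CNF formula obtained by taking $\mathit{EQ}$ out of the scope of quantifiers in $\exists W[\mathit{EQ}\wedge F'\wedge F'']$, i.e. such that $$H\wedge \exists W[F'\wedge F''] \;\equiv\; \exists W[\mathit{EQ}\wedge F'\wedge F''].$$ Then $N'$ and $N''$ are functionally equivalent (i.e. for every $\vec{x}\in\{0,1\}^k$, $N'$ and $N''$ output the same value when both are given input $\vec{x}$) if and only if at least one of the following holds: (1) $H(0,1)=H(1,0)=0$; (2) $N'$ and $N''$ are identical constants, i.e. $N'\equiv N''\equiv 0$ or $N'\equiv N''\equiv 1$.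
   Context: A CNF formula $F(X,Y,Z)$ is said to specify a combinational circuit $N(X,Y,Z)$ (with input variables $X$, internal variables $Y$, output variables $Z$) if the satisfying assignments of $F$ are exactly the assignments to $X\cup Y\cup Z$ that are consistent with the circuit, i.e. in which every internal and output variable takes the value computed by its gate from the values of its fan-in variables. The quantified formula $\exists W[\Phi]$ is viewed as a Boolean function of the remaining (free) variables, here $z',z''$; equivalence $\equiv$ of formulas means equality as Boolean functions of the free variables. -}

module Defs where

open import Data.Nat using (ℕ; zero; suc)
open import Data.Fin using (Fin; zero; suc)
open import Data.Bool using (Bool; true; false; not; _∧_; _∨_)
open import Data.List using (List; []; _∷_)
open import Data.Unit using (⊤; tt)
open import Data.Product using (Σ; _×_; _,_)
open import Data.Sum using (_⊎_)
open import Function using (_∘_)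
open import Function.Bundles using (_⇔_)
open import Relation.Binary.PropositionalEquality using (_≡_)

Inputs : ℕ → Set
Inputs k = Fin k → Bool

-- A chain of m internal gates over k inputs, in topological order.
-- The newest gate is internal variable 'zero'; the older ones are 'suc j'.
-- Each gate computes a Boolean function of the inputs and of the earlier
-- internal variables (its fan-in is an arbitrary subset of these).
Gates : ℕ → ℕ → Set
Gates k zero    = ⊤
Gates k (suc m) = Gates k m × ((Fin k → Bool) → (Fin m → Bool) → Bool)

record Circuit (k : ℕ) : Set where
  field
    nInt  : ℕ
    gates : Gates k nInt
    outG  : (Fin k → Bool) → (Fin nInt → Bool) → Bool
open Circuit public

evalGates : ∀ {k m} → Gates k m → Inputs k → Fin m → Bool
evalGates {m = zero}  _        x ()
evalGates {m = suc m} (gs , g) x zero    = g x (evalGates gs x)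
evalGates {m = suc m} (gs , g) x (suc j) = evalGates gs x j

output : ∀ {k} → Circuit k → Inputs k → Bool
output N x = outG N x (evalGates (gates N) x)

GatesConsistent : ∀ {k m} → Gates k m → Inputs k → (Fin m → Bool) → Set
GatesConsistent {m = zero}  _        x y = ⊤
GatesConsistent {m = suc m} (gs , g) x y =
  (y zero ≡ g x (y ∘ suc)) × GatesConsistent gs x (y ∘ suc)

Consistent : ∀ {k} (N : Circuit k) → Inputs k → (Fin (nInt N) → Bool) → Bool → Set
Consistent N x y z = GatesConsistent (gates N) x y × (z ≡ outG N x y)

data Lit (V : Set) : Set where
  pos : V → Lit V
  neg : V → Lit V

Clause : Set → Set
Clause V = List (Lit V)

CNF : Set → Set
CNF V = List (Clause V)

evalLit : ∀ {V} → (V → Bool) → Lit V → Bool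
evalLit σ (pos v) = σ v
evalLit σ (neg v) = not (σ v)

evalClause : ∀ {V} → (V → Bool) → Clause V → Bool
evalClause σ []      = false
evalClause σ (l ∷ c) = evalLit σ l ∨ evalClause σ c

evalCNF : ∀ {V} → (V → Bool) → CNF V → Bool
evalCNF σ []      = true
evalCNF σ (c ∷ f) = evalClause σ c ∧ evalCNF σ f

data CVar (k m : ℕ) : Set where
  inp : Fin k → CVar k m
  int : Fin m → CVar k m
  out : CVar k m

assign : ∀ {k m} → (Fin k → Bool) → (Fin m → Bool) → Bool → CVar k m → Bool
assign x y z (inp i) = x i
assign x y z (int j) = y j
assign x y z out     = z

Specifies : ∀ {k} (N : Circuit k) → CNF (CVar k (nInt N)) → Set
Specifies {k} N F =
  ∀ (x : Fin k → Bool) (y : Fin (nInt N) → Bool) (z : Bool) →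
    (evalCNF (assign x y z) F ≡ true) ⇔ Consistent N x y z

EQ : ∀ {k} → (Fin k → Bool) → (Fin k → Bool) → Set
EQ x′ x″ = ∀ i → x′ i ≡ x″ i

ExF'F'' : ∀ {k} (N′ N″ : Circuit k) →
  CNF (CVar k (nInt N′)) → CNF (CVar k (nInt N″)) → Bool → Bool → Set
ExF'F'' {k} N′ N″ F′ F″ a b =
  Σ (Fin k → Bool) λ x′ → Σ (Fin (nInt N′) → Bool) λ y′ →
  Σ (Fin k → Bool) λ x″ → Σ (Fin (nInt N″) → Bool) λ y″ →
    (evalCNF (assign x′ y′ a) F′ ≡ true) × (evalCNF (assign x″ y″ b) F″ ≡ true)

ExEqF'F'' : ∀ {k} (N′ N″ : Circuit k) →
  CNF (CVar k (nInt N′)) → CNF (CVar k (nInt N″)) → Bool → Bool → Set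
ExEqF'F'' {k} N′ N″ F′ F″ a b =
  Σ (Fin k → Bool) λ x′ → Σ (Fin (nInt N′) → Bool) λ y′ →
  Σ (Fin k → Bool) λ x″ → Σ (Fin (nInt N″) → Bool) λ y″ →
    EQ x′ x″ ×
    (evalCNF (assign x′ y′ a) F′ ≡ true) × (evalCNF (assign x″ y″ b) F″ ≡ true)

data ZVar : Set where
  z′ z″ : ZVar

zAssign : Bool → Bool → ZVar → Bool
zAssign a b z′ = a
zAssign a b z″ = b

evalH : CNF ZVar → Bool → Bool → Bool
evalH H a b = evalCNF (zAssign a b) H

FunctionallyEquivalent : ∀ {k} → Circuit k → Circuit k → Set
FunctionallyEquivalent {k} N′ N″ = ∀ (x : Fin k → Bool) → output N′ x ≡ output N″ x

IdenticalConstants : ∀ {k} → Circuit k → Circuit k → Set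
IdenticalConstants {k} N′ N″ =
    (∀ (x : Fin k → Bool) → (output N′ x ≡ false) × (output N″ x ≡ false))
  ⊎ (∀ (x : Fin k → Bool) → (output N′ x ≡ true) × (output N″ x ≡ true))

-- The proof separates a Boolean-function argument from the circuit
-- bookkeeping.  For f g : X → Bool, call (a,b) *jointly* realised if some
-- x has f x = a and g x = b, and *separately* realised if a is a value of f
-- and b a value of g.  The defining property of H says exactly that
-- ∃W[EQ ∧ F′ ∧ F″] is the joint realisability of the outputs and that
-- H ∧ ∃W[F′ ∧ F″] is H together with separate realisability.  The abstract
-- criterion (equivalence-criterion) states: if H is true at every jointly
-- realised pair and H ∧ separate ⇒ joint, then f = g iff H vanishes at
-- (0,1) and (1,0) or f, g are the same constant.
module Submission where

open import Defs
open import Data.Nat using (ℕ; zero; suc)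
open import Data.Fin using (Fin; zero; suc)
open import Data.Bool using (Bool; true; false; not; _∧_; _∨_)
open import Data.List using ([]; _∷_)
open import Data.Vec using (_∷_; tabulate; lookup)
open import Data.Vec.Properties using (lookup∘tabulate)
open import Data.Unit using (tt)
open import Data.Empty using (⊥)
open import Data.Product using (Σ; _×_; _,_; proj₁; proj₂)
open import Data.Sum using (_⊎_; inj₁; inj₂)
open import Function using (_∘_)
open import Function.Bundles using (_⇔_; Equivalence; mk⇔)
open import Relation.Nullary using (¬_)
open import Relation.Binary.PropositionalEquality
  using (_≡_; refl; sym; trans; cong; cong₂)

open Equivalence

module _ {X : Set} (f g : X → Bool) where

  Joint : Bool → Bool → Set
  Joint a b = Σ X λ x → (f x ≡ a) × (g x ≡ b)

  Separate : Bool → Bool → Set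
  Separate a b = (Σ X λ x → f x ≡ a) × (Σ X λ x → g x ≡ b)

  SameConstant : Set
  SameConstant = (∀ x → (f x ≡ false) × (g x ≡ false))
               ⊎ (∀ x → (f x ≡ true) × (g x ≡ true))

agree-unless-opposite : ∀ (a u v : Bool) →
  ¬ ((u ≡ a) × (v ≡ not a)) → ¬ ((v ≡ a) × (u ≡ not a)) → u ≡ v
agree-unless-opposite _     false false _ _ = refl
agree-unless-opposite _     true  true  _ _ = refl
agree-unless-opposite false false true  p _ with () ← p (refl , refl)
agree-unless-opposite true  false true  _ q with () ← q (refl , refl)
agree-unless-opposite false true  false _ q with () ← q (refl , refl)
agree-unless-opposite true  true  false p _ with () ← p (refl , refl)

not-fixed : ∀ (a : Bool) → ¬ (a ≡ not a)
not-fixed false ()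
not-fixed true  ()

constant-if-one-sided : ∀ {X : Set} (f : X → Bool) (a : Bool) →
  (∀ x y → f x ≡ a → f y ≡ not a → ⊥) → ∀ x y → f x ≡ f y
constant-if-one-sided f a one-sided x y =
  agree-unless-opposite a (f x) (f y)
    (λ (p , q) → one-sided x y p q) (λ (p , q) → one-sided y x p q)

-- Equal functions of which one is constant are the same constant; the
-- point x₀ tells us which constant.
same-constant : ∀ {X : Set} (x₀ : X) (f g : X → Bool) →
  (∀ x → f x ≡ g x) → (∀ x → f x ≡ f x₀) → SameConstant f g
same-constant x₀ f g f≡g const with f x₀
... | false = inj₁ λ x → const x , trans (sym (f≡g x)) (const x)
... | true  = inj₂ λ x → const x , trans (sym (f≡g x)) (const x)

same-constant⇒equal : ∀ {X : Set} (f g : X → Bool) → SameConstant f g → ∀ x → f x ≡ g x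
same-constant⇒equal f g (inj₁ c) x = trans (proj₁ (c x)) (sym (proj₂ (c x)))
same-constant⇒equal f g (inj₂ c) x = trans (proj₁ (c x)) (sym (proj₂ (c x)))

equal-if-h-separates : ∀ {X : Set} (f g : X → Bool) (h : Bool → Bool → Bool) →
  (∀ a b → Joint f g a b → h a b ≡ true) →
  h false true ≡ false → h true false ≡ false → ∀ x → f x ≡ g x
equal-if-h-separates f g h h-of-joint h01 h10 x with f x in ef | g x in eg
... | false | false = refl
... | true  | true  = refl
... | false | true  with () ← trans (sym h01) (h-of-joint false true (x , ef , eg))
... | true  | false with () ← trans (sym h10) (h-of-joint true false (x , ef , eg))

-- For equal functions, h a (not a) = true forces f to be constant:
-- values a and not a of f at two points are separately realised, hence
-- jointly realised at a single point, where f = g cannot differ.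
constant-if-h-mixed : ∀ {X : Set} (x₀ : X) (f g : X → Bool) (h : Bool → Bool → Bool) →
  (∀ a b → h a b ≡ true → Separate f g a b → Joint f g a b) →
  (∀ x → f x ≡ g x) → ∀ a → h a (not a) ≡ true → SameConstant f g
constant-if-h-mixed x₀ f g h joint-of-h f≡g a ha =
  same-constant x₀ f g f≡g λ x → constant-if-one-sided f a one-sided x x₀
  where
    one-sided : ∀ x y → f x ≡ a → f y ≡ not a → ⊥
    one-sided x y fx fy
      with joint-of-h a (not a) ha ((x , fx) , (y , trans (sym (f≡g y)) fy))
    ... | z , fz , gz = not-fixed a (trans (sym fz) (trans (f≡g z) gz))

equivalence-criterion : ∀ {X : Set} (x₀ : X) (f g : X → Bool) (h : Bool → Bool → Bool) →
  (∀ a b → h a b ≡ true → Separate f g a b → Joint f g a b) →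
  (∀ a b → Joint f g a b → h a b ≡ true) →
  (∀ x → f x ≡ g x) ⇔
    (((h false true ≡ false) × (h true false ≡ false)) ⊎ SameConstant f g)
equivalence-criterion x₀ f g h joint-of-h h-of-joint = mk⇔ forward backward
  where
    forward : (∀ x → f x ≡ g x) →
      ((h false true ≡ false) × (h true false ≡ false)) ⊎ SameConstant f g
    forward f≡g with h false true in h01 | h true false in h10
    ... | false | false = inj₁ (refl , refl)
    ... | true  | _     = inj₂ (constant-if-h-mixed x₀ f g h joint-of-h f≡g false h01)
    ... | false | true  = inj₂ (constant-if-h-mixed x₀ f g h joint-of-h f≡g true h10)

    backward : ((h false true ≡ false) × (h true false ≡ false)) ⊎ SameConstant f g →
      ∀ x → f x ≡ g x
    backward (inj₁ (h01 , h10)) = equal-if-h-separates f g h h-of-joint h01 h10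
    backward (inj₂ same)        = same-constant⇒equal f g same

lit-cong : ∀ {V} {σ τ : V → Bool} → (∀ v → σ v ≡ τ v) → ∀ l → evalLit σ l ≡ evalLit τ l
lit-cong σ≗τ (pos v) = σ≗τ v
lit-cong σ≗τ (neg v) = cong not (σ≗τ v)

clause-cong : ∀ {V} {σ τ : V → Bool} → (∀ v → σ v ≡ τ v) →
  ∀ c → evalClause σ c ≡ evalClause τ c
clause-cong σ≗τ []      = refl
clause-cong σ≗τ (l ∷ c) = cong₂ _∨_ (lit-cong σ≗τ l) (clause-cong σ≗τ c)

cnf-cong : ∀ {V} {σ τ : V → Bool} → (∀ v → σ v ≡ τ v) → ∀ F → evalCNF σ F ≡ evalCNF τ F
cnf-cong σ≗τ []      = refl
cnf-cong σ≗τ (c ∷ F) = cong₂ _∧_ (clause-cong σ≗τ c) (cnf-cong σ≗τ F)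

-- Gates are arbitrary functions of assignments, so without function
-- extensionality we compare internal assignments through their
-- tabulations.  canon y is pointwise equal to y, and canon y ∘ suc is
-- definitionally canon (y ∘ suc), which is what the recursion needs.
canon : ∀ {m} → (Fin m → Bool) → Fin m → Bool
canon y = lookup (tabulate y)

evalGates-consistent : ∀ {k m} (gs : Gates k m) x → GatesConsistent gs x (evalGates gs x)
evalGates-consistent {m = zero}  gs       x = tt
evalGates-consistent {m = suc m} (gs , g) x = refl , evalGates-consistent gs x

-- Consistent internal assignments are unique: the gate chain determines
-- each internal variable from the inputs and the earlier ones.
consistent-unique : ∀ {k m} (gs : Gates k m) x (y w : Fin m → Bool) →
  GatesConsistent gs x (canon y) → GatesConsistent gs x (canon w) →
  tabulate y ≡ tabulate w
consistent-unique {m = zero}  gs       x y w _ _ = refl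
consistent-unique {m = suc m} (gs , g) x y w (y₀ , ys) (w₀ , ws) =
  cong₂ _∷_ (trans y₀ (trans (cong (g x ∘ lookup) rest) (sym w₀))) rest
  where
    rest : tabulate (y ∘ suc) ≡ tabulate (w ∘ suc)
    rest = consistent-unique gs x (y ∘ suc) (w ∘ suc) ys ws

module _ {k} (N : Circuit k) (F : CNF (CVar k (nInt N))) (S : Specifies N F) where

  satisfying⇒consistent : ∀ x y z → evalCNF (assign x y z) F ≡ true →
    Consistent N x (canon y) z
  satisfying⇒consistent x y z sat = to (S x (canon y) z) (trans (cnf-cong same F) sat)
    where
      same : ∀ v → assign x (canon y) z v ≡ assign x y z v
      same (inp i) = refl
      same (int j) = lookup∘tabulate y j
      same out     = refl

  computed-satisfies : ∀ x z → z ≡ output N x →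
    evalCNF (assign x (evalGates (gates N) x) z) F ≡ true
  computed-satisfies x z z≡out = from (S x _ z) (evalGates-consistent (gates N) x , z≡out)

  -- In any satisfying assignment of F, z is the circuit's output on the
  -- inputs (given up to pointwise equality, as EQ provides them).
  satisfying⇒output : ∀ x x₁ y z → EQ x x₁ → evalCNF (assign x₁ y z) F ≡ true →
    z ≡ output N x
  satisfying⇒output x x₁ y z x≗x₁ sat =
    trans (proj₂ given) (trans (cong (outG N x ∘ lookup) internal) (sym (proj₂ computed)))
    where
      same : ∀ v → assign x y z v ≡ assign x₁ y z v
      same (inp i) = x≗x₁ i
      same (int j) = refl
      same out     = refl
      given : Consistent N x (canon y) z
      given = satisfying⇒consistent x y z (trans (cnf-cong same F) sat)
      computed : Consistent N x (canon (evalGates (gates N) x)) (output N x)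
      computed = satisfying⇒consistent x (evalGates (gates N) x) (output N x)
                   (computed-satisfies x (output N x) refl)
      internal : tabulate y ≡ tabulate (evalGates (gates N) x)
      internal = consistent-unique (gates N) x y (evalGates (gates N) x)
                   (proj₁ given) (proj₁ computed)

exEq⇔joint : ∀ {k} (N′ N″ : Circuit k)
  (F′ : CNF (CVar k (nInt N′))) (F″ : CNF (CVar k (nInt N″))) →
  Specifies N′ F′ → Specifies N″ F″ → ∀ a b →
  ExEqF'F'' N′ N″ F′ F″ a b ⇔ Joint (output N′) (output N″) a b
exEq⇔joint N′ N″ F′ F″ S′ S″ a b = mk⇔ extract build
  where
    extract : ExEqF'F'' N′ N″ F′ F″ a b → Joint (output N′) (output N″) a b
    extract (x′ , y′ , x″ , y″ , x′≗x″ , sat′ , sat″) =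
      x′ , sym (satisfying⇒output N′ F′ S′ x′ x′ y′ a (λ _ → refl) sat′)
         , sym (satisfying⇒output N″ F″ S″ x′ x″ y″ b x′≗x″ sat″)

    build : Joint (output N′) (output N″) a b → ExEqF'F'' N′ N″ F′ F″ a b
    build (x , out′ , out″) = x , _ , x , _ , (λ _ → refl)
      , computed-satisfies N′ F′ S′ x a (sym out′)
      , computed-satisfies N″ F″ S″ x b (sym out″)

separate⇒exF : ∀ {k} (N′ N″ : Circuit k)
  (F′ : CNF (CVar k (nInt N′))) (F″ : CNF (CVar k (nInt N″))) →
  Specifies N′ F′ → Specifies N″ F″ → ∀ a b →
  Separate (output N′) (output N″) a b → ExF'F'' N′ N″ F′ F″ a b
separate⇒exF N′ N″ F′ F″ S′ S″ a b ((x′ , out′) , (x″ , out″)) = x′ , _ , x″ , _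
  , computed-satisfies N′ F′ S′ x′ a (sym out′)
  , computed-satisfies N″ F″ S″ x″ b (sym out″)

proposition1 : ∀ (k : ℕ) (N′ N″ : Circuit k)
    (F′ : CNF (CVar k (nInt N′))) (F″ : CNF (CVar k (nInt N″))) →
    Specifies N′ F′ → Specifies N″ F″ →
    ∀ (H : CNF ZVar) →
    (∀ (a b : Bool) →
    ((evalH H a b ≡ true) × ExF'F'' N′ N″ F′ F″ a b) ⇔ ExEqF'F'' N′ N″ F′ F″ a b) →
    FunctionallyEquivalent N′ N″ ⇔
    (((evalH H false true ≡ false) × (evalH H true false ≡ false))
    ⊎ IdenticalConstants N′ N″)
proposition1 k N′ N″ F′ F″ S′ S″ H H-spec =
  equivalence-criterion (λ _ → false) (output N′) (output N″) (evalH H)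
    joint-of-H H-of-joint
  where
    exEq⇔ : ∀ a b → ExEqF'F'' N′ N″ F′ F″ a b ⇔ Joint (output N′) (output N″) a b
    exEq⇔ = exEq⇔joint N′ N″ F′ F″ S′ S″

    joint-of-H : ∀ a b → evalH H a b ≡ true →
      Separate (output N′) (output N″) a b → Joint (output N′) (output N″) a b
    joint-of-H a b Hab sep = to (exEq⇔ a b)
      (to (H-spec a b) (Hab , separate⇒exF N′ N″ F′ F″ S′ S″ a b sep))

    H-of-joint : ∀ a b → Joint (output N′) (output N″) a b → evalH H a b ≡ true
    H-of-joint a b joint = proj₁ (from (H-spec a b) (from (exEq⇔ a b) joint))
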